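{- Let $p$ be a prime and $1\leq r\leq p$. Let $\psi:\mathbb{Z}_p\to\mathbb{Z}_p$ be a function for which there exist $A_1,\ldots,A_{r-1}\in\mathbb{Z}_p$ such that $$\psi(tp)\equiv\psi(0)+\sum_{k=1}^{r-1}\frac{A_k}{k!}(tp)^k\pmod{p^r}\quad\text{for all }t\in\mathbb{Z}_p.$$ Let $a_1,\ldots,a_r\in\mathbb{Z}_p$ with $a_i\not\equiv a_j\pmod p$ for all $1\leq i<j\leq r$, and suppose $\psi(a_ip)\equiv0\pmod{p^r}$ for each $1\leq i\leq r$. Then $\psi(sp)\equiv0\pmod{p^r}$ for every $s\in\mathbb{Z}_p$, and $A_k\equiv0\pmod{p^{r-k}}$ for each $1\leq k\leq r-1$.
   Context: $\mathbb{Z}_p$ denotes the ring of $p$-adic integers. -}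

module Defs where

open import Data.Nat using (_∸_; ℕ; zero; suc; _+_; _*_; _^_; _%_; NonZero)
open import Data.Nat.Properties using (m^n≢0)
open import Data.Fin using (Fin; toℕ)
import Data.Fin as Fin
open import Relation.Binary.PropositionalEquality using (_≡_)

-- The p-adic integers ℤ_p, represented by their p-adic digit expansion
-- x = Σ_{i ≥ 0} x(i) p^i with digits x(i) ∈ {0,…,p-1}.
Zp : ℕ → Set
Zp p = ℕ → Fin p

digit0 : (p : ℕ) → .{{NonZero p}} → Fin p
digit0 (suc q) = Fin.zero

zeroZp : (p : ℕ) → .{{NonZero p}} → Zp p
zeroZp p _ = digit0 p

timesP : (p : ℕ) → .{{NonZero p}} → Zp p → Zp p
timesP p x zero    = digit0 p
timesP p x (suc i) = x i

res : (p : ℕ) → ℕ → Zp p → ℕ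
res p zero    x = 0
res p (suc n) x = toℕ (x 0) + p * res p n (λ i → x (suc i))

modPow : (p : ℕ) → .{{NonZero p}} → ℕ → ℕ → ℕ
modPow p n m = _%_ m (p ^ n) {{m^n≢0 p n}}

Divisible : (p : ℕ) → ℕ → Zp p → Set
Divisible p n x = res p n x ≡ 0

-- q = a / m in ℤ_p, i.e. m · q = a in ℤ_p (checked modulo every p^n)
IsQuotient : (p : ℕ) → .{{NonZero p}} → (m : ℕ) → (a q : Zp p) → Set
IsQuotient p m a q = ∀ n → modPow p n (m * res p n q) ≡ res p n a

sum1to : ℕ → (ℕ → ℕ) → ℕ
sum1to zero    f = 0
sum1to (suc m) f = sum1to m f + f (suc m)

taylorRes : (p : ℕ) → .{{NonZero p}} → (r : ℕ) → (ψ0 : Zp p) → (B : ℕ → Zp p) → (tp : Zp p) → ℕ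
taylorRes p r ψ0 B tp =
  modPow p r (res p r ψ0 + sum1to (r ∸ 1) (λ k → res p r (B k) * res p r tp ^ k))

-- Expanding (tp)^k, ψ(tp) ≡ f(t) (mod p^r) for the integer polynomial f(x) = ψ(0) + Σ_{0<k<r} B_k p^k x^k.
-- The a_i are pairwise incongruent mod p, so their differences are cancellable mod p^r, and a polynomial
-- of degree < r vanishing mod p^r at r such points has all coefficients ≡ 0 mod p^r (divide by x - a_1
-- and induct on r). Hence ψ(sp) ≡ f(s) ≡ 0 for every s, and p^r ∣ B_k p^k gives p^(r-k) ∣ B_k ∣ A_k.
module Submission where

open import Defs
open import Data.Fin using (Fin; toℕ)
import Data.Fin as Fin
open import Data.Fin.Properties using (toℕ<n; suc-injective)
open import Data.Vec using (Vec; []; _∷_; _∷ʳ_)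
open import Data.Vec.Relation.Unary.All using (All; []; _∷_)
open import Data.Product using (_×_; _,_)
open import Data.Sum using (inj₁; inj₂)
open import Function using (_∘_)
open import Relation.Nullary using (¬_; contradiction)
open import Relation.Binary.PropositionalEquality

∷ʳ⁻ : ∀ {A : Set} {P : A → Set} {n} (xs : Vec A n) {x : A} → All P (xs ∷ʳ x) → All P xs × P x
∷ʳ⁻ []       (px ∷ [])   = [] , px
∷ʳ⁻ (_ ∷ xs) (px ∷ pxs) with ∷ʳ⁻ xs pxs
... | pxs′ , py = px ∷ pxs′ , py

module Polynomial where

  open import Data.Nat using (ℕ; zero; suc)
  open import Data.Integer using (ℤ; 0ℤ; 1ℤ; _+_; _-_; _*_; _^_)
  open import Data.Integer.Divisibility.Signed
    using (_∣_; divides; ∣m∣n⇒∣m+n; ∣m+n∣m⇒∣n; ∣m+n∣n⇒∣m; ∣n⇒∣m*n)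
  open import Data.Integer.Tactic.RingSolver using (solve-∀)

  private variable
    n : ℕ
    m : ℤ

  private
    ∣0 : m ∣ 0ℤ
    ∣0 = divides 0ℤ refl

  eval : Vec ℤ n → ℤ → ℤ
  eval []       x = 0ℤ
  eval (c ∷ cs) x = c + x * eval cs x

  eval-∷ʳ : (cs : Vec ℤ n) (c x : ℤ) → eval (cs ∷ʳ c) x ≡ eval cs x + c * x ^ n
  eval-∷ʳ []       c x = lemma c x
    where lemma : ∀ c x → c + x * 0ℤ ≡ 0ℤ + c * 1ℤ
          lemma = solve-∀
  eval-∷ʳ {suc n} (d ∷ ds) c x = begin
    d + x * eval (ds ∷ʳ c) x             ≡⟨ cong (λ e → d + x * e) (eval-∷ʳ ds c x) ⟩
    d + x * (eval ds x + c * x ^ n)      ≡⟨ lemma d x (eval ds x) c (x ^ n) ⟩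
    d + x * eval ds x + c * (x * x ^ n)  ∎
    where open ≡-Reasoning
          lemma : ∀ d x e c y → d + x * (e + c * y) ≡ d + x * e + c * (x * y)
          lemma = solve-∀

  eval-∣ : {cs : Vec ℤ n} (x : ℤ) → All (m ∣_) cs → m ∣ eval cs x
  eval-∣ x []           = ∣0
  eval-∣ x (m∣c ∷ m∣cs) = ∣m∣n⇒∣m+n m∣c (∣n⇒∣m*n x (eval-∣ x m∣cs))

  quotient : ℤ → Vec ℤ (suc n) → Vec ℤ n
  quotient a (c ∷ [])     = []
  quotient a (c ∷ d ∷ cs) = eval (d ∷ cs) a ∷ quotient a (d ∷ cs)

  eval-quotient : (cs : Vec ℤ (suc n)) (a x : ℤ) →
                  eval cs x ≡ eval cs a + (x - a) * eval (quotient a cs) x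
  eval-quotient (c ∷ [])     a x = lemma c a x
    where lemma : ∀ c a x → c + x * 0ℤ ≡ c + a * 0ℤ + (x - a) * 0ℤ
          lemma = solve-∀
  eval-quotient (c ∷ d ∷ cs) a x = begin
    c + x * eval (d ∷ cs) x            ≡⟨ cong (λ y → c + x * y) (eval-quotient (d ∷ cs) a x) ⟩
    c + x * (e + (x - a) * q)          ≡⟨ lemma c a x e q ⟩
    c + a * e + (x - a) * (e + x * q)  ∎
    where open ≡-Reasoning
          e q : ℤ
          e = eval (d ∷ cs) a
          q = eval (quotient a (d ∷ cs)) x
          lemma : ∀ c a x e q →
                  c + x * (e + (x - a) * q) ≡ c + a * e + (x - a) * (e + x * q)
          lemma = solve-∀

  ∣-quotient⇒∣-coefficients : (cs : Vec ℤ (suc n)) (a : ℤ) → m ∣ eval cs a →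
                              All (m ∣_) (quotient a cs) → All (m ∣_) cs
  ∣-quotient⇒∣-coefficients (c ∷ [])     a m∣f[a] [] =
    ∣m+n∣n⇒∣m m∣f[a] (∣n⇒∣m*n a ∣0) ∷ []
  ∣-quotient⇒∣-coefficients (c ∷ d ∷ cs) a m∣f[a] (m∣e ∷ m∣q) =
    ∣m+n∣n⇒∣m m∣f[a] (∣n⇒∣m*n a m∣e) ∷ ∣-quotient⇒∣-coefficients (d ∷ cs) a m∣e m∣q

  Separated : ℤ → (Fin n → ℤ) → Set
  Separated m xs = ∀ i j → i ≢ j → ∀ e → m ∣ (xs i - xs j) * e → m ∣ e

  ∣-at-separated-points⇒∣-coefficients : (xs : Fin n → ℤ) → Separated m xs →
    (cs : Vec ℤ n) → (∀ i → m ∣ eval cs (xs i)) → All (m ∣_) cs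
  ∣-at-separated-points⇒∣-coefficients {zero}          xs separated []  m∣f[xs] = []
  ∣-at-separated-points⇒∣-coefficients {suc n} {m = m} xs separated cs m∣f[xs] =
    ∣-quotient⇒∣-coefficients cs a (m∣f[xs] Fin.zero)
      (∣-at-separated-points⇒∣-coefficients (xs ∘ Fin.suc) separated′ (quotient a cs) m∣q[xs])
    where
    a : ℤ
    a = xs Fin.zero
    separated′ : Separated m (xs ∘ Fin.suc)
    separated′ i j i≢j = separated (Fin.suc i) (Fin.suc j) (i≢j ∘ suc-injective)
    m∣q[xs] : ∀ i → m ∣ eval (quotient a cs) (xs (Fin.suc i))
    m∣q[xs] i = separated (Fin.suc i) Fin.zero (λ ()) _
      (∣m+n∣m⇒∣n (subst (m ∣_) (eval-quotient cs a (xs (Fin.suc i))) (m∣f[xs] (Fin.suc i)))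
                 (m∣f[xs] Fin.zero))

open Polynomial using (eval; eval-∷ʳ; eval-∣; Separated; ∣-at-separated-points⇒∣-coefficients)

open import Data.Nat using (ℕ; zero; suc; _+_; _*_; _^_; _∸_; _%_; _!; _≤_; _<_; s≤s; NonZero)
open import Data.Nat.Properties
  using (m^n≢0; ^-distribˡ-+-*; +-assoc; +-comm; +-identityʳ; *-identityˡ; *-assoc; *-comm;
         [m*n]*[o*p]≡[m*o]*[n*p]; m∸n+n≡m; <⇒≤; ≤-pred; ⊔-lub; ≤-<-trans; m≤n⇒m<n∨m≡n)
open import Data.Nat.Divisibility
  using (_∣_; divides; 1∣_; m∣m*n; ∣n⇒∣m*n; ∣-trans; ∣m+n∣m⇒∣n; *-monoˡ-∣; *-cancelˡ-∣; *-cancelʳ-∣;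
         n∣m⇒m%n≡0; m%n≡0⇒n∣m)
open import Data.Nat.DivMod using (m<n⇒m%n≡m)
open import Data.Nat.Primality using (Prime; euclidsLemma; prime⇒nonZero)
open import Data.Nat.Tactic.RingSolver as ℕ-Solver using ()
open import Data.Integer as ℤ using (ℤ; +_; 0ℤ; ∣_∣)
import Data.Integer.Properties as ℤ
open import Data.Integer.Divisibility.Signed as ℤ∣ using (∣ᵤ⇒∣; ∣⇒∣ᵤ)
open import Data.Integer.Tactic.RingSolver using (solve-∀)

^-distrib-* : ∀ a b k → (a * b) ^ k ≡ a ^ k * b ^ k
^-distrib-* a b zero    = refl
^-distrib-* a b (suc k) =
  trans (cong (a * b *_) (^-distrib-* a b k)) ([m*n]*[o*p]≡[m*o]*[n*p] a b (a ^ k) (b ^ k))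

pos-^ : ∀ a k → + (a ^ k) ≡ (+ a) ℤ.^ k
pos-^ a zero    = refl
pos-^ a (suc k) = trans (ℤ.pos-* a (a ^ k)) (cong ((+ a) ℤ.*_) (pos-^ a k))

prime^-cancelˡ : ∀ {p d} → Prime p → ¬ p ∣ d → ∀ n {e} → p ^ n ∣ d * e → p ^ n ∣ e
prime^-cancelˡ _ _ zero {e} _ = 1∣ e
prime^-cancelˡ {p} {d} p-prime p∤d (suc n) {e} p^[1+n]∣de
  with euclidsLemma d e p-prime (∣-trans (m∣m*n (p ^ n)) p^[1+n]∣de)
... | inj₁ p∣d = contradiction p∣d p∤d
... | inj₂ (divides q refl) =
  subst (_∣ q * p) (*-comm (p ^ n) p) (*-monoˡ-∣ p (prime^-cancelˡ p-prime p∤d n p^n∣dq))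
  where
  instance _ = prime⇒nonZero p-prime
  rearrange : ∀ d q p → d * (q * p) ≡ p * (d * q)
  rearrange = ℕ-Solver.solve-∀
  p^n∣dq : p ^ n ∣ d * q
  p^n∣dq = *-cancelˡ-∣ p (subst (p * p ^ n ∣_) (rearrange d q p) p^[1+n]∣de)

prime^-cancelˡ-ℤ : ∀ {p d e} → Prime p → ¬ + p ℤ∣.∣ d → ∀ n →
  + (p ^ n) ℤ∣.∣ d ℤ.* e → + (p ^ n) ℤ∣.∣ e
prime^-cancelˡ-ℤ {d = d} {e} p-prime p∤d n p^n∣de =
  ∣ᵤ⇒∣ (prime^-cancelˡ p-prime (p∤d ∘ ∣ᵤ⇒∣) n (subst (_ ∣_) (ℤ.abs-* d e) (∣⇒∣ᵤ p^n∣de)))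

∣-difference⇒low-digits≡ : ∀ {p x y} u v .{{_ : NonZero p}} → x < p → y < p →
  + p ℤ∣.∣ + (x + p * u) ℤ.- + (y + p * v) → x ≡ y
∣-difference⇒low-digits≡ {p} {x} {y} u v x<p y<p p∣ =
  ℤ.+-injective (ℤ.i-j≡0⇒i≡j _ _ (ℤ.∣i∣≡0⇒i≡0 ∣x-y∣≡0))
  where
  cast : ∀ d e → + (d + p * e) ≡ + d ℤ.+ + p ℤ.* + e
  cast d e = trans (ℤ.pos-+ d (p * e)) (cong (λ w → + d ℤ.+ w) (ℤ.pos-* p e))
  regroup : ∀ x y u v p → x ℤ.+ p ℤ.* u ℤ.- (y ℤ.+ p ℤ.* v) ≡ x ℤ.- y ℤ.+ (u ℤ.- v) ℤ.* p
  regroup = solve-∀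
  p∣x-y : + p ℤ∣.∣ + x ℤ.- + y
  p∣x-y = ℤ∣.∣m+n∣n⇒∣m
    (subst (+ p ℤ∣.∣_) (trans (cong₂ ℤ._-_ (cast x u) (cast y v)) (regroup (+ x) (+ y) (+ u) (+ v) (+ p))) p∣)
    (ℤ∣.∣n⇒∣m*n (+ u ℤ.- + v) ℤ∣.∣-refl)
  ∣x-y∣<p : ∣ + x ℤ.- + y ∣ < p
  ∣x-y∣<p = subst (_< p) (cong ∣_∣ (sym (ℤ.[+m]-[+n]≡m⊖n x y)))
    (≤-<-trans (ℤ.∣m⊝n∣≤m⊔n x y) (⊔-lub x<p y<p))
  ∣x-y∣≡0 : ∣ + x ℤ.- + y ∣ ≡ 0
  ∣x-y∣≡0 = trans (sym (m<n⇒m%n≡m ∣x-y∣<p)) (n∣m⇒m%n≡0 _ p (∣⇒∣ᵤ p∣x-y))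

res-timesP : ∀ p .{{_ : NonZero p}} n (t : Zp p) → res p (suc n) (timesP p t) ≡ p * res p n t
res-timesP (suc _) n t = refl

res-+ : ∀ p m n (x : Zp p) → res p (m + n) x ≡ res p m x + p ^ m * res p n (λ i → x (m + i))
res-+ p zero    n x = sym (*-identityˡ _)
res-+ p (suc m) n x = begin
  d + p * res p (m + n) (x ∘ suc)              ≡⟨ cong (λ y → d + p * y) (res-+ p m n (x ∘ suc)) ⟩
  d + p * (res p m (x ∘ suc) + p ^ m * rest)   ≡⟨ regroup d p (res p m (x ∘ suc)) (p ^ m) rest ⟩
  d + p * res p m (x ∘ suc) + p * p ^ m * rest ∎
  where open ≡-Reasoning
        d rest : ℕ
        d = toℕ (x 0)
        rest = res p n (λ i → x (suc m + i))
        regroup : ∀ d p r q s → d + p * (r + q * s) ≡ d + p * r + p * q * s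
        regroup = ℕ-Solver.solve-∀

∣res-+⇒∣res : ∀ p m n (x : Zp p) → p ^ m ∣ res p (m + n) x → p ^ m ∣ res p m x
∣res-+⇒∣res p m n x p^m∣ =
  ∣m+n∣m⇒∣n (subst (p ^ m ∣_) (trans (res-+ p m n x) (+-comm (res p m x) _)) p^m∣) (m∣m*n rest)
  where rest : ℕ
        rest = res p n (λ i → x (m + i))

∣-scaled-quotient⇒Divisible : ∀ {p} .{{_ : NonZero p}} {m a q r k} → k ≤ r → IsQuotient p m a q →
  p ^ r ∣ res p r q * p ^ k → Divisible p (r ∸ k) a
∣-scaled-quotient⇒Divisible {p} {m = m} {a} {q} {r} {k} k≤r a≡m*q p^r∣q*p^k =
  trans (sym (a≡m*q e)) (n∣m⇒m%n≡0 _ _ {{m^n≢0 p e}} (∣n⇒∣m*n m p^e∣res[e]q))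
  where
  e : ℕ
  e = r ∸ k
  e+k≡r : e + k ≡ r
  e+k≡r = m∸n+n≡m k≤r
  p^e∣res[r]q : p ^ e ∣ res p r q
  p^e∣res[r]q = *-cancelʳ-∣ (p ^ k) {{m^n≢0 p k}}
    (subst (_∣ res p r q * p ^ k) (trans (cong (p ^_) (sym e+k≡r)) (^-distribˡ-+-* p e k)) p^r∣q*p^k)
  p^e∣res[e]q : p ^ e ∣ res p e q
  p^e∣res[e]q = ∣res-+⇒∣res p e k q (subst (λ n → p ^ e ∣ res p n q) (sym e+k≡r) p^e∣res[r]q)

residues-incongruent : ∀ p .{{_ : NonZero p}} r′ (a : Fin (suc r′) → Zp p) →
  (∀ i j → i ≢ j → res p 1 (a i) ≢ res p 1 (a j)) →
  ∀ i j → i ≢ j → ¬ + p ℤ∣.∣ + res p r′ (a i) ℤ.- + res p r′ (a j)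
residues-incongruent p zero     a distinct Fin.zero Fin.zero i≢j _ = i≢j refl
residues-incongruent p (suc r″) a distinct i j i≢j p∣ =
  distinct i j i≢j
    (cong (λ d → d + p * 0) (∣-difference⇒low-digits≡ _ _ (toℕ<n (a i 0)) (toℕ<n (a j 0)) p∣))

taylorPolynomial : (c₀ : ℕ) (b : ℕ → ℕ) (p m : ℕ) → Vec ℤ (suc m)
taylorPolynomial c₀ b p zero    = + c₀ ∷ []
taylorPolynomial c₀ b p (suc m) = taylorPolynomial c₀ b p m ∷ʳ + (b (suc m) * p ^ suc m)

eval-taylorPolynomial : ∀ c₀ b p m x →
  + (c₀ + sum1to m (λ k → b k * (p * x) ^ k)) ≡ eval (taylorPolynomial c₀ b p m) (+ x)
eval-taylorPolynomial c₀ b p zero x = trans (cong +_ (+-identityʳ c₀)) (sym (lemma (+ c₀) (+ x)))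
  where lemma : ∀ c x → c ℤ.+ x ℤ.* 0ℤ ≡ c
        lemma = solve-∀
eval-taylorPolynomial c₀ b p (suc m) x = begin
  + (c₀ + (s + t))                                  ≡⟨ cong +_ (sym (+-assoc c₀ s t)) ⟩
  + (c₀ + s + t)                                    ≡⟨ ℤ.pos-+ (c₀ + s) t ⟩
  + (c₀ + s) ℤ.+ + t                                ≡⟨ cong₂ ℤ._+_ (eval-taylorPolynomial c₀ b p m x) term ⟩
  eval f (+ x) ℤ.+ + (b k * p ^ k) ℤ.* (+ x) ℤ.^ k  ≡⟨ sym (eval-∷ʳ f _ (+ x)) ⟩
  eval (f ∷ʳ + (b k * p ^ k)) (+ x)                 ∎
  where
  open ≡-Reasoning
  k s t : ℕ
  k = suc m
  s = sum1to m (λ k → b k * (p * x) ^ k)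
  t = b k * (p * x) ^ k
  f : Vec ℤ (suc m)
  f = taylorPolynomial c₀ b p m
  term : + t ≡ + (b k * p ^ k) ℤ.* (+ x) ℤ.^ k
  term = begin
    + (b k * (p * x) ^ k)              ≡⟨ cong (λ y → + (b k * y)) (^-distrib-* p x k) ⟩
    + (b k * (p ^ k * x ^ k))          ≡⟨ cong +_ (sym (*-assoc (b k) _ _)) ⟩
    + (b k * p ^ k * x ^ k)            ≡⟨ ℤ.pos-* (b k * p ^ k) (x ^ k) ⟩
    + (b k * p ^ k) ℤ.* + (x ^ k)      ≡⟨ cong (λ y → + (b k * p ^ k) ℤ.* y) (pos-^ x k) ⟩
    + (b k * p ^ k) ℤ.* (+ x) ℤ.^ k    ∎

∣-taylorPolynomial⇒∣-terms : ∀ {M c₀ b p} m → All (M ℤ∣.∣_) (taylorPolynomial c₀ b p m) →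
  ∀ k → 1 ≤ k → k ≤ m → M ℤ∣.∣ + (b k * p ^ k)
∣-taylorPolynomial⇒∣-terms zero    _   (suc k) _ ()
∣-taylorPolynomial⇒∣-terms {c₀ = c₀} {b} {p} (suc m) M∣f k 1≤k k≤1+m
  with ∷ʳ⁻ (taylorPolynomial c₀ b p m) M∣f | m≤n⇒m<n∨m≡n k≤1+m
... | M∣f′ , _     | inj₁ (s≤s k≤m) = ∣-taylorPolynomial⇒∣-terms m M∣f′ k 1≤k k≤m
... | _    , M∣top | inj₂ refl      = M∣top

theorem2p1 : (p r : ℕ) → .{{_ : NonZero p}} → Prime p → 1 ≤ r → r ≤ p →
    (ψ : Zp p → Zp p) → (A B : ℕ → Zp p) →
    (∀ k → 1 ≤ k → k < r → IsQuotient p (k !) (A k) (B k)) →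
    (∀ t → res p r (ψ (timesP p t)) ≡ taylorRes p r (ψ (zeroZp p)) B (timesP p t)) →
    (a : Fin r → Zp p) →
    (∀ i j → i ≢ j → res p 1 (a i) ≢ res p 1 (a j)) →
    (∀ i → Divisible p r (ψ (timesP p (a i)))) →
    (∀ s → Divisible p r (ψ (timesP p s))) ×
    (∀ k → 1 ≤ k → k < r → Divisible p (r ∸ k) (A k))
theorem2p1 p zero _ ()
theorem2p1 p r@(suc r′) p-prime _ _ ψ A B A≡k!*B ψ-taylor a distinct ψ[ap]≡0 = ψ[sp]≡0 , A-divisible
  where
  instance _ = m^n≢0 p r
  M : ℕ
  M = p ^ r
  c₀ : ℕ
  c₀ = res p r (ψ (zeroZp p))
  b : ℕ → ℕ
  b k = res p r (B k)
  f : Vec ℤ r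
  f = taylorPolynomial c₀ b p r′
  -- res p r (timesP p t) is exactly p * res p r′ t, so f is evaluated at the truncation res p r′ t.
  value : Zp p → ℕ
  value t = c₀ + sum1to r′ (λ k → b k * (p * res p r′ t) ^ k)

  ψ[tp]≡value%M : ∀ t → res p r (ψ (timesP p t)) ≡ value t % M
  ψ[tp]≡value%M t = trans (ψ-taylor t)
    (cong (λ y → modPow p r (c₀ + sum1to r′ (λ k → b k * y ^ k))) (res-timesP p r′ t))

  value≡f[t] : ∀ t → + value t ≡ eval f (+ res p r′ t)
  value≡f[t] t = eval-taylorPolynomial c₀ b p r′ (res p r′ t)

  M∣f[a] : ∀ i → + M ℤ∣.∣ eval f (+ res p r′ (a i))
  M∣f[a] i = subst (+ M ℤ∣.∣_) (value≡f[t] (a i))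
    (∣ᵤ⇒∣ (m%n≡0⇒n∣m _ M (trans (sym (ψ[tp]≡value%M (a i))) (ψ[ap]≡0 i))))

  separated : Separated (+ M) (λ i → + res p r′ (a i))
  separated i j i≢j _ = prime^-cancelˡ-ℤ p-prime (residues-incongruent p r′ a distinct i j i≢j) r

  M∣f : All (+ M ℤ∣.∣_) f
  M∣f = ∣-at-separated-points⇒∣-coefficients _ separated f M∣f[a]

  ψ[sp]≡0 : ∀ s → Divisible p r (ψ (timesP p s))
  ψ[sp]≡0 s = trans (ψ[tp]≡value%M s)
    (n∣m⇒m%n≡0 _ M (∣⇒∣ᵤ (subst (+ M ℤ∣.∣_) (sym (value≡f[t] s)) (eval-∣ _ M∣f))))

  A-divisible : ∀ k → 1 ≤ k → k < r → Divisible p (r ∸ k) (A k)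
  A-divisible k 1≤k k<r = ∣-scaled-quotient⇒Divisible {m = k !} {q = B k} (<⇒≤ k<r) (A≡k!*B k 1≤k k<r)
    (∣⇒∣ᵤ (∣-taylorPolynomial⇒∣-terms r′ M∣f k 1≤k (≤-pred k<r)))
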